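{- Let $H$ be a digraph (possibly with loops), $D$ an $H$-colored digraph, and $\mathscr{F}$ a walk-preservative $H$-class partition of $A(D)$ such that $C_{\mathscr{F}}(D)$ has a $(k,l)$-kernel $\mathcal{S}$ (with $k\ge2$, $l\ge1$). Suppose: (a) $C_{\mathscr{F}}(D)$ has no sinks, and every cycle in $C_{\mathscr{F}}(D)$ is either a loop or has length at least $k$; (b) for every $x\in V(D)$ with $N_{\mathscr{F}}(x)\cap\mathcal{S}\neq\emptyset$ and $N_{\mathscr{F}}(x)\cap N^{+}(\mathcal{S})\neq\emptyset$, we have $N^{ - }_{\mathscr{F}}(x)\subseteq\mathcal{S}$. Then $D$ has a $(k,l+1,H)$-kernel by walks.
   Context: An $H$-colored digraph is a finite digraph $D$ without loops with a coloring $\rho:A(D)\to V(H)$. For $F\subseteq A(D)$, $D\langle F\rangle$ is the digraph with arc set $F$ and vertex set the vertices incident with an arc of $F$. An $H$-class partition of $A(D)$ is a partition $\mathscr{F}$ of $A(D)$ such that for all arcs $(u,v),(v,w)$ of $D$, $(\rho(u,v),\rho(v,w))\in A(H)$ iff some $F\in\mathscr{F}$ contains both arcs. The $H$-class digraph $C_{\mathscr{F}}(D)$ has vertex set $\mathscr{F}$, and $(F,G)$ (possibly a loop) is an arc iff there exist $(u,v)\in F$ and $(v,w)\in G$. $\mathscr{F}$ is walk-preservative if for every arc $(F,G)$ of $C_{\mathscr{F}}(D)$ and every $z\in V(D\langle F\rangle)$ there is a $zw$-path in $D\langle F\rangle$ for some $w\in V(D\langle G\rangle)$. In a digraph possibly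 with loops, a sink is a vertex whose only possible out-going arc is a loop. For $x\in V(D)$: $N^-_{\mathscr{F}}(x)=\{F:(u,x)\in F\text{ for some }u\}$, $N^+_{\mathscr{F}}(x)=\{F:(x,v)\in F\text{ for some }v\}$, $N_{\mathscr{F}}(x)=N^+_{\mathscr{F}}(x)\cup N^-_{\mathscr{F}}(x)$. $N^+(\mathcal{S})$ is the proper out-neighborhood of $\mathcal{S}$ in $C_{\mathscr{F}}(D)$. A $(k,l)$-kernel of a digraph is a set $S$ such that every walk between two different vertices of $S$ has length at least $k$ and every vertex not in $S$ has a walk of length at most $l$ to $S$. For a walk $W=(x_0,\ldots,x_n)$ in $D$, there is an obstruction on $x_i$ if $(\rho(x_{i-1},x_i),\rho(x_i,x_{i+1}))\notin A(H)$; for open $W$, the $H$-length is $1$ plus the number of $i\in\{1,\ldots,n-1\}$ with an obstruction on $x_i$. A set $S\subseteq V(D)$ is a $(k,l,H)$-kernel by walks if every walk between two different vertices of $S$ has $H$-length at least $k$ and every $x\notin S$ has a walk to $S$ of $H$-length at most $l$. -}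

module Defs where

open import Data.Nat using (ℕ; zero; suc; _+_; _≤_)
open import Data.Fin using (Fin)
open import Data.Fin.Subset using (Subset; _∈_; _∉_)
open import Data.Bool using (Bool; true; false; T; if_then_else_)
open import Data.List using (List; []; _∷_)
open import Data.List.Relation.Unary.Unique.Propositional using (Unique)
open import Data.Product using (Σ; ∃; ∃-syntax; _×_; _,_)
open import Data.Sum using (_⊎_)
open import Data.Empty using (⊥)
open import Relation.Nullary using (¬_)
open import Relation.Binary.PropositionalEquality using (_≡_; _≢_)

data Walk {A : Set} (R : A → A → Set) : A → A → ℕ → Set where
  nil  : ∀ {x} → Walk R x x 0
  cons : ∀ {x y z n} → R x y → Walk R y z n → Walk R x z (suc n)

targets : ∀ {A : Set} {R : A → A → Set} {x y n} → Walk R x y n → List A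
targets nil = []
targets (cons {y = y} _ w) = y ∷ targets w

vertices : ∀ {A : Set} {R : A → A → Set} {x y n} → Walk R x y n → List A
vertices {x = x} w = x ∷ targets w

Path : ∀ {A : Set} (R : A → A → Set) → A → A → Set
Path R x y = Σ ℕ λ n → Σ (Walk R x y n) λ w → Unique (vertices w)

IsCycle : ∀ {A : Set} {R : A → A → Set} {x n} → Walk R x x n → Set
IsCycle {n = n} w = (1 ≤ n) × Unique (targets w)

IsKLKernel : ∀ {p} (R : Fin p → Fin p → Set) (k l : ℕ) → Subset p → Set
IsKLKernel {p} R k l S =
  (∀ (x y : Fin p) → x ∈ S → y ∈ S → x ≢ y → ∀ n → Walk R x y n → k ≤ n)
  × (∀ (x : Fin p) → x ∉ S → ∃[ y ] ∃[ n ] (y ∈ S × n ≤ l × Walk R x y n))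

IsSink : ∀ {p} (R : Fin p → Fin p → Set) → Fin p → Set
IsSink {p} R i = ∀ (j : Fin p) → R i j → j ≡ i

record Digraph : Set where
  field
    m    : ℕ
    harc : Fin m → Fin m → Bool

-- H-colored digraph: finite loopless digraph on Fin n with arc colouring
-- ρ (only its values on arcs are relevant).
record HColoredDigraph (H : Digraph) : Set where
  field
    n        : ℕ
    adj      : Fin n → Fin n → Bool
    loopless : ∀ (v : Fin n) → ¬ T (adj v v)
    ρ        : Fin n → Fin n → Fin (Digraph.m H)

  Arc : Fin n → Fin n → Set
  Arc u v = T (adj u v)

-- A partition of A(D) into p (nonempty, pairwise distinct) classes,
-- given by a labelling of the arcs (values on non-arcs irrelevant).
record ArcPartition {H : Digraph} (D : HColoredDigraph H) : Set where
  open HColoredDigraph D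
  field
    p        : ℕ
    cls      : Fin n → Fin n → Fin p
    nonempty : ∀ (i : Fin p) → ∃[ u ] ∃[ v ] (Arc u v × cls u v ≡ i)

module _ {H : Digraph} {D : HColoredDigraph H} where
  open Digraph H
  open HColoredDigraph D

  IsHClassPartition : ArcPartition D → Set
  IsHClassPartition P =
    ∀ (u v w : Fin n) → Arc u v → Arc v w →
      (T (harc (ρ u v) (ρ v w)) → cls u v ≡ cls v w)
      × (cls u v ≡ cls v w → T (harc (ρ u v) (ρ v w)))
    where open ArcPartition P

  module _ (P : ArcPartition D) where
    open ArcPartition P

    CArc : Fin p → Fin p → Set
    CArc i j = ∃[ u ] ∃[ v ] ∃[ w ]
      (Arc u v × Arc v w × cls u v ≡ i × cls v w ≡ j)

    ClassArc : Fin p → Fin n → Fin n → Set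
    ClassArc i u v = Arc u v × cls u v ≡ i

    InClassV : Fin p → Fin n → Set
    InClassV i z = ∃[ v ] (ClassArc i z v ⊎ ClassArc i v z)

    IsWalkPreservative : Set
    IsWalkPreservative =
      ∀ (i j : Fin p) → CArc i j → ∀ (z : Fin n) → InClassV i z →
        ∃[ w ] (InClassV j w × Path (ClassArc i) z w)

    InNminus : Fin n → Fin p → Set
    InNminus x i = ∃[ u ] ClassArc i u x

    InNplus : Fin n → Fin p → Set
    InNplus x i = ∃[ v ] ClassArc i x v

    InN : Fin n → Fin p → Set
    InN x i = InNplus x i ⊎ InNminus x i

    InOutNbhd : Subset p → Fin p → Set
    InOutNbhd S j = j ∉ S × ∃[ i ] (i ∈ S × CArc i j)

  obsCount : ∀ {y z k} → Fin m → Walk Arc y z k → ℕ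
  obsCount c nil = 0
  obsCount c (cons {x = y} {y = y'} _ w) =
    (if harc c (ρ y y') then 0 else 1) + obsCount (ρ y y') w

  Hlength : ∀ {x z k} → Walk Arc x z k → ℕ
  Hlength nil = 0   -- not used: only walks of length ≥ 1 (between different vertices) occur
  Hlength (cons {x = x} {y = y} _ w) = suc (obsCount (ρ x y) w)

  IsKLHKernelByWalks : ℕ → ℕ → Subset n → Set
  IsKLHKernelByWalks k l S =
    (∀ (x y : Fin n) → x ∈ S → y ∈ S → x ≢ y →
       ∀ t (w : Walk Arc x y t) → k ≤ Hlength w)
    × (∀ (x : Fin n) → x ∉ S →
       ∃[ y ] ∃[ t ] Σ (Walk Arc x y t) λ w → y ∈ S × Hlength w ≤ l)

-- The kernel by walks consists of the vertices without arcs together with the least vertex of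
-- each terminal strong component, for reachability along arcs whose class lies in S, of the set
-- of exit vertices: those all of whose in-arcs lie in classes of S and which have an out-arc in
-- a class outside S. The obstructions along a walk are exactly its changes of class, so a walk of
-- D with c class changes, started after an in-arc of class A, yields a loopless walk of length c
-- in C_F(D) from A. Between two chosen vertices both ends of that walk lie in S, hence c ≥ k (a
-- closed loopless walk contains a cycle that is not a loop), while c = 0 would keep the walk in
-- one class of S and so inside one terminal component. Conversely, walk-preservation lifts the
-- walk of length ≤ l from the class of an out-arc of x to S into a walk of D with ≤ l class
-- changes ending in a class A ∈ S; from there hypothesis (b) and the absence of sinks lead, within
-- A, to an exit vertex, and arcs with class in S lead on to a chosen vertex. The same two
-- hypotheses show that no vertex has in-arcs but no out-arcs.

module Submission where

open import Defs
open import Data.Nat using (ℕ; zero; suc; _+_; _≤_; z≤n; s≤s)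
open import Data.Nat.Properties
  using (≤-trans; ≤-refl; ≤-reflexive; <⇒≤; m≤n⇒m≤1+n; +-monoˡ-≤; m≤n+m; +-comm; module ≤-Reasoning)
open import Data.Fin using (Fin; zero; suc; _≟_) renaming (_≤_ to _≤ᶠ_)
open import Data.Fin.Properties using (injective⇒≤; ≤-antisym; any?; all?) renaming (_≤?_ to _≤ᶠ?_)
open import Data.Fin.Subset using (Subset; _∈_; _∉_; _⊂_)
open import Data.Fin.Subset.Properties using (_∈?_)
open import Data.Fin.Subset.Induction using (Acc; acc; ⊂-wellFounded)
open import Data.Vec using (tabulate)
open import Data.Vec.Properties using (lookup∘tabulate; lookup⇒[]=; []=⇒lookup)
open import Data.Bool using (if_then_else_)
open import Data.List using (List; []; _∷_; length; lookup)
open import Data.List.Membership.Propositional using () renaming (_∈_ to _∈ˡ_)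
open import Data.List.Membership.Propositional.Properties using (∈-lookup)
open import Data.List.Relation.Unary.All using ([]) renaming (lookup to lookupᴬ)
open import Data.List.Relation.Unary.All.Properties.Core using (¬Any⇒All¬)
open import Data.List.Relation.Unary.Any using (here; there)
open import Data.List.Relation.Unary.AllPairs using ([]; _∷_)
open import Data.List.Relation.Unary.Unique.Propositional using (Unique)
open import Data.Product using (Σ; ∃; ∃-syntax; _×_; _,_; proj₁; proj₂)
open import Data.Sum using (_⊎_; inj₁; inj₂)
open import Data.Empty using (⊥-elim)
open import Function using (_∘_; Injective; mk⇔)
open import Relation.Nullary using (¬_; Dec; yes; no; does)
open import Relation.Nullary.Decidable using (_×-dec_; _⊎-dec_; _→-dec_; ¬?; map′; dec-true; does-⇔; T?)
open import Level using (0ℓ)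
open import Relation.Unary using (Pred; Decidable)
open import Relation.Binary.Definitions using (DecidableEquality)
open import Relation.Binary.PropositionalEquality using (_≡_; _≢_; refl; sym; trans; cong; cong₂; subst)

module _ {A : Set} {R : A → A → Set} where

  infixr 5 _++ᵂ_
  _++ᵂ_ : ∀ {x y z m n} → Walk R x y m → Walk R y z n → Walk R x z (m + n)
  nil      ++ᵂ w = w
  cons r v ++ᵂ w = cons r (v ++ᵂ w)

  mapᵂ : ∀ {R′ : A → A → Set} → (∀ {a b} → R a b → R′ a b) →
         ∀ {x y t} → Walk R x y t → Walk R′ x y t
  mapᵂ f nil        = nil
  mapᵂ f (cons r w) = cons (f r) (mapᵂ f w)

  lastArc : ∀ {x y t} → Walk R x y (suc t) → ∃[ u ] R u y
  lastArc (cons r nil)        = _ , r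
  lastArc (cons _ (cons r w)) = lastArc (cons r w)

  length-vertices : ∀ {x y t} (w : Walk R x y t) → length (vertices w) ≡ suc t
  length-vertices nil        = refl
  length-vertices (cons _ w) = cong suc (length-vertices w)

  PathWithin : ℕ → A → A → Set
  PathWithin t x y = ∃[ m ] (m ≤ t × Σ (Walk R x y m) λ p → Unique (vertices p))

  dropUntil : ∀ {x y z t} (w : Walk R x y t) → z ∈ˡ vertices w →
              Unique (vertices w) → PathWithin t z y
  dropUntil w          (here refl) u       = _ , ≤-refl , w , u
  dropUntil (cons _ w) (there z∈)  (_ ∷ u) with dropUntil w z∈ u
  ... | m , m≤t , p , up = m , m≤n⇒m≤1+n m≤t , p , up

  module _ (_≟ᴬ_ : DecidableEquality A) where
    open import Data.List.Membership.DecPropositional _≟ᴬ_ using () renaming (_∈?_ to _∈ˡ?_)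

    toPath : ∀ {x y t} → Walk R x y t → PathWithin t x y
    toPath nil = 0 , z≤n , nil , [] ∷ []
    toPath (cons {x = x} r w) with toPath w
    ... | m , m≤t , p , up with x ∈ˡ? vertices p
    ...   | yes x∈ = let (m′ , m′≤m , p′ , up′) = dropUntil p x∈ up
                     in m′ , m≤n⇒m≤1+n (≤-trans m′≤m m≤t) , p′ , up′
    ...   | no x∉  = suc m , s≤s m≤t , cons r p , ¬Any⇒All¬ _ x∉ ∷ up

    closedWalk⇒k≤length : ∀ {k} → (∀ z t (c : Walk R z z t) → IsCycle c → t ≡ 1 ⊎ k ≤ t) →
                          ∀ {a b t} → R a b → a ≢ b → Walk R b a t → k ≤ suc t
    closedWalk⇒k≤length cycles r a≢b w with toPath w
    ... | m , m≤t , p , up with cycles _ _ (cons r p) (s≤s z≤n , up)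
    ...   | inj₂ k≤ = ≤-trans k≤ (s≤s m≤t)
    closedWalk⇒k≤length cycles r a≢b w | 0 , _ , nil , _ | inj₁ refl = ⊥-elim (a≢b refl)

Unique⇒lookup-injective : ∀ {A : Set} {xs : List A} → Unique xs → Injective _≡_ _≡_ (lookup xs)
Unique⇒lookup-injective {xs = _ ∷ _}  (_  ∷ _) {zero}  {zero}  _ = refl
Unique⇒lookup-injective {xs = _ ∷ xs} (x∉ ∷ _) {zero}  {suc j} e = ⊥-elim (lookupᴬ x∉ (∈-lookup {xs = xs} j) e)
Unique⇒lookup-injective {xs = _ ∷ xs} (x∉ ∷ _) {suc i} {zero}  e = ⊥-elim (lookupᴬ x∉ (∈-lookup {xs = xs} i) (sym e))
Unique⇒lookup-injective {xs = _ ∷ _}  (_ ∷ u)  {suc i} {suc j} e = cong suc (Unique⇒lookup-injective u e)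

Unique⇒length≤ : ∀ {n} {xs : List (Fin n)} → Unique xs → length xs ≤ n
Unique⇒length≤ u = injective⇒≤ (Unique⇒lookup-injective u)

least : ∀ {n} {Q : Pred (Fin n) 0ℓ} → Decidable Q → ∃ Q → ∃[ i ] (Q i × ∀ j → Q j → i ≤ᶠ j)
least {suc n} Q? (i , qi) with Q? zero
... | yes q₀ = zero , q₀ , λ _ _ → z≤n
least {suc n} Q? (zero , q₀) | no ¬q₀ = ⊥-elim (¬q₀ q₀)
least {suc n} Q? (suc i , qi) | no ¬q₀ with least (Q? ∘ suc) (i , qi)
... | j , qj , j-least = suc j , qj , λ { zero q₀ → ⊥-elim (¬q₀ q₀) ; (suc m) qm → s≤s (j-least m qm) }

module _ {n} {P : Pred (Fin n) 0ℓ} (P? : Decidable P) where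

  toSubset : Subset n
  toSubset = tabulate (does ∘ P?)

  ∈-toSubset⁺ : ∀ {x} → P x → x ∈ toSubset
  ∈-toSubset⁺ {x} px = lookup⇒[]= x toSubset (trans (lookup∘tabulate (does ∘ P?) x) (dec-true (P? x) px))

  ∈-toSubset⁻ : ∀ {x} → x ∈ toSubset → P x
  ∈-toSubset⁻ {x} x∈ with P? x | trans (sym (lookup∘tabulate (does ∘ P?) x)) ([]=⇒lookup x∈)
  ... | yes px | _  = px
  ... | no _   | ()

module Reachability {n} {R : Fin n → Fin n → Set} (R? : ∀ x y → Dec (R x y)) where

  Reach : Fin n → Fin n → Set
  Reach x y = ∃[ t ] Walk R x y t

  reach-refl : ∀ {x} → Reach x x
  reach-refl = 0 , nil

  reach-trans : ∀ {x y z} → Reach x y → Reach y z → Reach x z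
  reach-trans (_ , v) (_ , w) = _ , v ++ᵂ w

  private
    WalkWithin : ℕ → Fin n → Fin n → Set
    WalkWithin zero    x y = x ≡ y
    WalkWithin (suc b) x y = x ≡ y ⊎ ∃[ v ] (R x v × WalkWithin b v y)

    walkWithin? : ∀ b x y → Dec (WalkWithin b x y)
    walkWithin? zero    x y = x ≟ y
    walkWithin? (suc b) x y = (x ≟ y) ⊎-dec any? (λ v → R? x v ×-dec walkWithin? b v y)

    walkWithin⇒reach : ∀ b {x y} → WalkWithin b x y → Reach x y
    walkWithin⇒reach zero    refl                = reach-refl
    walkWithin⇒reach (suc b) (inj₁ refl)         = reach-refl
    walkWithin⇒reach (suc b) (inj₂ (_ , r , ww)) = reach-trans (1 , cons r nil) (walkWithin⇒reach b ww)

    walk⇒walkWithin : ∀ {b x y t} → Walk R x y t → t ≤ b → WalkWithin b x y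
    walk⇒walkWithin {zero}  nil        _         = refl
    walk⇒walkWithin {suc b} nil        _         = inj₁ refl
    walk⇒walkWithin {suc b} (cons r w) (s≤s t≤b) = inj₂ (_ , r , walk⇒walkWithin w t≤b)

    reach⇒walkWithin : ∀ {x y} → Reach x y → WalkWithin n x y
    reach⇒walkWithin (_ , w) with toPath _≟_ w
    ... | _ , _ , p , up =
      walk⇒walkWithin p (<⇒≤ (subst (_≤ n) (length-vertices p) (Unique⇒length≤ up)))

  reach? : ∀ x y → Dec (Reach x y)
  reach? x y = map′ (walkWithin⇒reach n) reach⇒walkWithin (walkWithin? n x y)

module TerminalRepresentatives {n} {E : Pred (Fin n) 0ℓ} (E? : Decidable E)
  {_≼_ : Fin n → Fin n → Set} (_≼?_ : ∀ x y → Dec (x ≼ y))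
  (≼-refl : ∀ {x} → x ≼ x) (≼-trans : ∀ {x y z} → x ≼ y → y ≼ z → x ≼ z) where

  Top : Fin n → Set
  Top x = E x × ∀ z → E z → x ≼ z → z ≼ x × x ≤ᶠ z

  top? : Decidable Top
  top? x = E? x ×-dec all? λ z → E? z →-dec (x ≼? z →-dec (z ≼? x ×-dec x ≤ᶠ? z))

  Top-unique : ∀ {x y} → Top x → Top y → x ≼ y → x ≡ y
  Top-unique (ex , x-top) (ey , y-top) x≼y with x-top _ ey x≼y
  ... | y≼x , x≤y = ≤-antisym x≤y (proj₂ (y-top _ ex y≼x))

  private
    Above : Fin n → Fin n → Set
    Above x z = E z × x ≼ z

    above? : ∀ x → Decidable (Above x)
    above? x z = E? z ×-dec x ≼? z

    above : Fin n → Subset n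
    above x = toSubset (above? x)

    Escape : Fin n → Fin n → Set
    Escape x z = E z × x ≼ z × ¬ z ≼ x

    escape-shrinks : ∀ {x z} → E x → Escape x z → above z ⊂ above x
    escape-shrinks {x} {z} ex (_ , x≼z , z⋠x) =
      (λ y∈ → let (ey , z≼y) = ∈-toSubset⁻ (above? z) y∈ in ∈-toSubset⁺ (above? x) (ey , ≼-trans x≼z z≼y)) ,
      x , ∈-toSubset⁺ (above? x) (ex , ≼-refl) , λ x∈ → z⋠x (proj₂ (∈-toSubset⁻ (above? z) x∈))

    reachTopFrom : ∀ {x} → Acc _⊂_ (above x) → E x → ∃[ y ] (Top y × x ≼ y)
    reachTopFrom {x} (acc rec) ex with any? (λ z → E? z ×-dec x ≼? z ×-dec ¬? (z ≼? x))
    ... | yes (z , esc@(ez , x≼z , _)) with reachTopFrom (rec (escape-shrinks ex esc)) ez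
    ...   | y , y-top , z≼y = y , y-top , ≼-trans x≼z z≼y
    reachTopFrom {x} (acc rec) ex | no ¬esc with least (above? x) (x , ex , ≼-refl)
    ...   | y , (ey , x≼y) , y-least = y , (ey , y-top) , x≼y
      where
      closed : ∀ z → E z → x ≼ z → z ≼ x
      closed z ez x≼z with z ≼? x
      ... | yes z≼x = z≼x
      ... | no z⋠x  = ⊥-elim (¬esc (z , ez , x≼z , z⋠x))

      y-top : ∀ z → E z → y ≼ z → z ≼ y × y ≤ᶠ z
      y-top z ez y≼z = ≼-trans (closed z ez x≼z) x≼y , y-least z (ez , x≼z)
        where x≼z = ≼-trans x≼y y≼z

  reachTop : ∀ {x} → E x → ∃[ y ] (Top y × x ≼ y)
  reachTop {x} = reachTopFrom (⊂-wellFounded (above x))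

module _ {p} {R : Fin p → Fin p → Set} where

  ProperArc : Fin p → Fin p → Set
  ProperArc i j = R i j × i ≢ j

  ¬sink⇒properSuccessor : (∀ i j → Dec (R i j)) → ∀ {i} → ¬ IsSink R i → ∃[ j ] (R i j × j ≢ i)
  ¬sink⇒properSuccessor R? {i} ¬sink with any? (λ j → R? i j ×-dec ¬? (j ≟ i))
  ... | yes succ = succ
  ... | no ¬succ = ⊥-elim (¬sink sink)
    where
    sink : IsSink R i
    sink j r with j ≟ i
    ... | yes j≡i = j≡i
    ... | no j≢i  = ⊥-elim (¬succ (j , r , j≢i))

  module _ {k l : ℕ} {S : Subset p} (ker : IsKLKernel R k l S) where

    kernel-absorbs : ∀ i → ∃[ j ] ∃[ m ] (j ∈ S × m ≤ l × Walk R i j m)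
    kernel-absorbs i with i ∈? S
    ... | yes i∈S = i , 0 , i∈S , z≤n , nil
    ... | no i∉S  = proj₂ ker i i∉S

    kernel-independent : 2 ≤ k → ∀ {i j} → i ∈ S → j ∈ S → R i j → i ≡ j
    kernel-independent 2≤k {i} {j} i∈S j∈S r with i ≟ j
    ... | yes i≡j = i≡j
    ... | no i≢j with ≤-trans 2≤k (proj₁ ker i j i∈S j∈S i≢j 1 (cons r nil))
    ...   | s≤s ()

    kernel-properWalk⇒k≤length : (∀ z t (c : Walk R z z t) → IsCycle c → t ≡ 1 ⊎ k ≤ t) →
                                 ∀ {i j t} → i ∈ S → j ∈ S → Walk ProperArc i j (suc t) → k ≤ suc t
    kernel-properWalk⇒k≤length cycles {i} {j} i∈S j∈S w with i ≟ j
    ... | no i≢j = proj₁ ker i j i∈S j∈S i≢j _ (mapᵂ proj₁ w)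
    kernel-properWalk⇒k≤length cycles i∈S j∈S (cons (r , i≢v) w) | yes refl =
      closedWalk⇒k≤length _≟_ cycles r i≢v (mapᵂ proj₁ w)

mismatch : ∀ {A : Set} → Dec A → ℕ
mismatch d = if does d then 0 else 1

mismatch≤1 : ∀ {A : Set} (d : Dec A) → mismatch d ≤ 1
mismatch≤1 (yes _) = z≤n
mismatch≤1 (no _)  = ≤-refl

module ClassChanges {H : Digraph} {D : HColoredDigraph H} (P : ArcPartition D) where
  open Digraph H
  open HColoredDigraph D
  open ArcPartition P

  classChanges : ∀ {x y t} → Fin p → Walk Arc x y t → ℕ
  classChanges c nil                        = 0
  classChanges c (cons {x = x} {y = y} _ w) = mismatch (c ≟ cls x y) + classChanges (cls x y) w

  classChanges-≤-suc : ∀ {x y t} c c′ (w : Walk Arc x y t) → classChanges c w ≤ suc (classChanges c′ w)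
  classChanges-≤-suc c c′ nil = z≤n
  classChanges-≤-suc c c′ (cons {x = x} {y = y} _ w) =
    ≤-trans (+-monoˡ-≤ _ (mismatch≤1 (c ≟ cls x y))) (s≤s (m≤n+m _ (mismatch (c′ ≟ cls x y))))

  classChanges-classWalk-++ : ∀ {a b d t s} F (q : Walk (ClassArc P F) a b t) (w : Walk Arc b d s) →
                              classChanges F (mapᵂ proj₁ q ++ᵂ w) ≡ classChanges F w
  classChanges-classWalk-++ F nil                 w = refl
  classChanges-classWalk-++ F (cons (_ , refl) q) w with F ≟ F
  ... | yes _  = classChanges-classWalk-++ F q w
  ... | no F≢F = ⊥-elim (F≢F refl)

  classChanges≡0⇒classWalk : ∀ {x y t} c (w : Walk Arc x y t) → classChanges c w ≡ 0 → Walk (ClassArc P c) x y t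
  classChanges≡0⇒classWalk c nil                        _ = nil
  classChanges≡0⇒classWalk c (cons {x = x} {y = y} a w) e with c ≟ cls x y
  ... | yes refl = cons (a , refl) (classChanges≡0⇒classWalk c w e)
  classChanges≡0⇒classWalk c (cons a w) () | no _

  properClassWalk : ∀ {c x y t} → InNminus P x c → (w : Walk Arc x y t) →
                    ∃[ c′ ] (InNminus P y c′ × Walk (ProperArc {R = CArc P}) c c′ (classChanges c w))
  properClassWalk x∈c nil = _ , x∈c , nil
  properClassWalk {c} (u , a₀ , e₀) (cons {x = x} {y = v} a w) with c ≟ cls x v
  ... | yes refl = properClassWalk (x , a , refl) w
  ... | no c≢d with properClassWalk (x , a , refl) w
  ...   | c′ , y∈c′ , cw = c′ , y∈c′ , cons ((u , x , v , a₀ , a , e₀ , refl) , c≢d) cw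

  module _ (hc : IsHClassPartition P) where

    harc≡sameClass : ∀ {u v w} → Arc u v → Arc v w → harc (ρ u v) (ρ v w) ≡ does (cls u v ≟ cls v w)
    harc≡sameClass a b = does-⇔ (mk⇔ (proj₁ (hc _ _ _ a b)) (proj₂ (hc _ _ _ a b))) (T? _) (_ ≟ _)

    obsCount≡classChanges : ∀ {u v y t} → Arc u v → (w : Walk Arc v y t) →
                            obsCount {H} {D} (ρ u v) w ≡ classChanges (cls u v) w
    obsCount≡classChanges a nil        = refl
    obsCount≡classChanges a (cons b w) =
      cong₂ _+_ (cong (λ same → if same then 0 else 1) (harc≡sameClass a b)) (obsCount≡classChanges b w)

    classChanges≤Hlength : ∀ {x y t} c (w : Walk Arc x y (suc t)) → classChanges c w ≤ Hlength {H} {D} w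
    classChanges≤Hlength c (cons {x = x} {y = y} a w) rewrite obsCount≡classChanges a w =
      +-monoˡ-≤ _ (mismatch≤1 (c ≟ cls x y))

    Hlength≤suc-classChanges : ∀ {x y t} c (w : Walk Arc x y (suc t)) → Hlength {H} {D} w ≤ suc (classChanges c w)
    Hlength≤suc-classChanges c (cons {x = x} {y = y} a w) rewrite obsCount≡classChanges a w =
      s≤s (m≤n+m _ (mismatch (c ≟ cls x y)))

module KernelByWalks {H : Digraph} {D : HColoredDigraph H} {P : ArcPartition D}
  (hc : IsHClassPartition P) (wp : IsWalkPreservative P)
  {k l : ℕ} (2≤k : 2 ≤ k) {S : Subset (ArcPartition.p P)} (ker : IsKLKernel (CArc P) k l S)
  (noSink : ∀ i → ¬ IsSink (CArc P) i)
  (cycles : ∀ i t (c : Walk (CArc P) i i t) → IsCycle c → t ≡ 1 ⊎ k ≤ t)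
  (inClasses⊆S : ∀ x → ∃[ i ] (InN P x i × i ∈ S) → ∃[ j ] (InN P x j × InOutNbhd P S j) →
                 ∀ i → InNminus P x i → i ∈ S)
  where
  open HColoredDigraph D
  open ArcPartition P
  open ClassChanges P

  arc? : ∀ u v → Dec (Arc u v)
  arc? u v = T? (adj u v)

  cArc? : ∀ i j → Dec (CArc P i j)
  cArc? i j = any? λ u → any? λ v → any? λ w →
    arc? u v ×-dec arc? v w ×-dec cls u v ≟ i ×-dec cls v w ≟ j

  S-properSuccessor : ∀ {i} → i ∈ S → ∃[ j ] (CArc P i j × j ∉ S)
  S-properSuccessor i∈S with ¬sink⇒properSuccessor cArc? (noSink _)
  ... | j , i→j , j≢i = j , i→j , λ j∈S → j≢i (sym (kernel-independent ker 2≤k i∈S j∈S i→j))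

  NoOutArc : Fin n → Set
  NoOutArc y = ∀ v → ¬ Arc y v

  inClass-step : ∀ {y F G} → NoOutArc y → InNminus P y F → CArc P F G → InNminus P y G
  inClass-step {y} {F} {G} noOut (u , y∈F) F→G with wp F G F→G y (u , inj₂ y∈F)
  ... | _ , (v , inj₁ (a , _)) , (_ , nil , _)          = ⊥-elim (noOut v a)
  ... | _ , (v , inj₂ y∈G)     , (_ , nil , _)          = v , y∈G
  ... | _ , _                  , (_ , cons (a , _) _ , _) = ⊥-elim (noOut _ a)

  inClass-along : ∀ {y F G t} → NoOutArc y → InNminus P y F → Walk (CArc P) F G t → InNminus P y G
  inClass-along noOut y∈F nil       = y∈F
  inClass-along noOut y∈F (cons c w) = inClass-along noOut (inClass-step noOut y∈F c) w

  noOutArc⇒noInArc : ∀ {y F} → NoOutArc y → ¬ InNminus P y F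
  noOutArc⇒noInArc {y} {F} noOut y∈F with kernel-absorbs ker F
  ... | G , _ , G∈S , _ , F↝G with S-properSuccessor G∈S
  ...   | j , G→j , j∉S = j∉S (inClasses⊆S y (G , inj₂ y∈G , G∈S) (j , inj₂ y∈j , j∉S , G , G∈S , G→j) j y∈j)
    where
    y∈G = inClass-along noOut y∈F F↝G
    y∈j = inClass-step noOut y∈G G→j

  Exit : Fin n → Set
  Exit x = (∃[ u ] Arc u x) × (∀ u → Arc u x → cls u x ∈ S) × (∃[ v ] (Arc x v × cls x v ∉ S))

  exit? : Decidable Exit
  exit? x = any? (λ u → arc? u x)
    ×-dec all? (λ u → arc? u x →-dec cls u x ∈? S)
    ×-dec any? (λ v → arc? x v ×-dec ¬? (cls x v ∈? S))

  SArc : Fin n → Fin n → Set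
  SArc u v = Arc u v × cls u v ∈ S

  sArc? : ∀ u v → Dec (SArc u v)
  sArc? u v = arc? u v ×-dec cls u v ∈? S

  open Reachability sArc? using (reach?; reach-refl; reach-trans)
  open TerminalRepresentatives exit? reach? reach-refl reach-trans using (Top; top?; Top-unique; reachTop)

  Isolated : Fin n → Set
  Isolated x = NoOutArc x × (∀ u → ¬ Arc u x)

  InT : Fin n → Set
  InT x = Isolated x ⊎ Top x

  inT? : Decidable InT
  inT? x = (all? (λ v → ¬? (arc? x v)) ×-dec all? (λ u → ¬? (arc? u x))) ⊎-dec top? x

  T : Subset n
  T = toSubset inT?

  classWalk-preserves-inArc : ∀ {A v w t} → InNminus P v A → Walk (ClassArc P A) v w t → InNminus P w A
  classWalk-preserves-inArc v∈A nil                = v∈A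
  classWalk-preserves-inArc _   (cons {x = v} a w) = classWalk-preserves-inArc (v , a) w

  sWalk⇒classWalk : ∀ {A v w t} → A ∈ S → InNminus P v A → Walk SArc v w t → Walk (ClassArc P A) v w t
  sWalk⇒classWalk A∈S v∈A nil = nil
  sWalk⇒classWalk A∈S (u , au , refl) (cons {x = v} (a , d∈S) w) =
    cons (a , sym same) (sWalk⇒classWalk A∈S (v , a , sym same) w)
    where same = kernel-independent ker 2≤k A∈S d∈S (u , v , _ , au , a , refl , refl)

  classWalk-toInArc : ∀ {A z} → InClassV P A z → ∃[ v ] (InNminus P v A × ∃[ t ] Walk (ClassArc P A) z v t)
  classWalk-toInArc (v , inj₁ za) = v , (_ , za) , 1 , cons za nil
  classWalk-toInArc (v , inj₂ vz) = _ , (v , vz) , 0 , nil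

  inClassV⇒inN : ∀ {i z} → InClassV P i z → InN P z i
  inClassV⇒inN (v , inj₁ zv) = inj₁ (v , zv)
  inClassV⇒inN (v , inj₂ vz) = inj₂ (v , vz)

  classWalk-toExit : ∀ {A v} → A ∈ S → InNminus P v A → ∃[ w ] (Exit w × ∃[ t ] Walk (ClassArc P A) v w t)
  classWalk-toExit {A} {v} A∈S v∈A with S-properSuccessor A∈S
  ... | G , A→G , G∉S with wp A G A→G v (proj₁ v∈A , inj₂ (proj₂ v∈A))
  ...   | w , w∈G , (t , q , _) = w , exit w∈G , t , q
    where
    w∈A = classWalk-preserves-inArc v∈A q
    inS : ∀ i → InNminus P w i → i ∈ S
    inS = inClasses⊆S w (A , inj₂ w∈A , A∈S) (G , inClassV⇒inN w∈G , G∉S , A , A∈S , A→G)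
    exit : InClassV P G w → Exit w
    exit (u , inj₁ (wu , e)) = (_ , proj₁ (proj₂ w∈A)) , (λ u′ a → inS _ (u′ , a , refl)) ,
                               (u , wu , λ d∈S → G∉S (subst (_∈ S) e d∈S))
    exit (u , inj₂ uw)       = ⊥-elim (G∉S (inS G (u , uw)))

  classWalk-toTop : ∀ {A z} → A ∈ S → InClassV P A z → ∃[ y ] (InT y × ∃[ t ] Walk (ClassArc P A) z y t)
  classWalk-toTop A∈S z∈A with classWalk-toInArc z∈A
  ... | v , v∈A , _ , z↝v with classWalk-toExit A∈S v∈A
  ...   | w , w-exit , _ , v↝w with reachTop w-exit
  ...     | y , y-top , _ , w↝y =
    y , inj₂ y-top , _ , z↝v ++ᵂ v↝w ++ᵂ sWalk⇒classWalk A∈S (classWalk-preserves-inArc v∈A v↝w) w↝y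

  cWalk⇒walk-toT : ∀ {F A m z} → A ∈ S → Walk (CArc P) F A m → InClassV P F z →
                   ∃[ y ] (InT y × ∃[ t ] Σ (Walk Arc z y t) λ w → classChanges F w ≤ m)
  cWalk⇒walk-toT {F} A∈S nil z∈F with classWalk-toTop A∈S z∈F
  ... | y , y∈T , _ , q = y , y∈T , _ , mapᵂ proj₁ q ++ᵂ nil , ≤-reflexive (classChanges-classWalk-++ F q nil)
  cWalk⇒walk-toT {F} {m = suc m} A∈S (cons {y = G} F→G G↝A) z∈F with wp F G F→G _ z∈F
  ... | _ , z′∈G , (_ , q , _) with cWalk⇒walk-toT A∈S G↝A z′∈G
  ...   | y , y∈T , _ , w , w-changes = y , y∈T , _ , mapᵂ proj₁ q ++ᵂ w , (begin
    classChanges F (mapᵂ proj₁ q ++ᵂ w) ≡⟨ classChanges-classWalk-++ F q w ⟩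
    classChanges F w                     ≤⟨ classChanges-≤-suc F G w ⟩
    suc (classChanges G w)               ≤⟨ s≤s w-changes ⟩
    suc m                                ∎)
    where open ≤-Reasoning

  outArc⇒absorbed : ∀ {x v} → x ∉ T → Arc x v →
                    ∃[ y ] ∃[ t ] Σ (Walk Arc x y t) λ w → y ∈ T × Hlength {H} {D} w ≤ l + 1
  outArc⇒absorbed {x} {v} x∉T a with kernel-absorbs ker (cls x v)
  ... | A , m , A∈S , m≤l , F↝A with cWalk⇒walk-toT A∈S F↝A (v , inj₁ (a , refl))
  ...   | y , y∈T , _ , nil , _ = ⊥-elim (x∉T (∈-toSubset⁺ inT? y∈T))
  ...   | y , y∈T , _ , w@(cons _ _) , w-changes = y , _ , w , ∈-toSubset⁺ inT? y∈T , (begin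
    Hlength {H} {D} w              ≤⟨ Hlength≤suc-classChanges hc (cls x v) w ⟩
    suc (classChanges (cls x v) w) ≤⟨ s≤s (≤-trans w-changes m≤l) ⟩
    suc l                          ≡⟨ +-comm 1 l ⟩
    l + 1                          ∎)
    where open ≤-Reasoning

  T-absorbent : ∀ x → x ∉ T → ∃[ y ] ∃[ t ] Σ (Walk Arc x y t) λ w → y ∈ T × Hlength {H} {D} w ≤ l + 1
  T-absorbent x x∉T with any? (arc? x)
  ... | yes (v , a) = outArc⇒absorbed x∉T a
  ... | no ¬out with any? (λ u → arc? u x)
  ...   | yes (u , a) = ⊥-elim (noOutArc⇒noInArc (λ v a → ¬out (v , a)) (u , a , refl))
  ...   | no ¬in      = ⊥-elim (x∉T (∈-toSubset⁺ inT? (inj₁ ((λ v a → ¬out (v , a)) , λ u a → ¬in (u , a)))))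

  Tops-≢⇒k≤Hlength : ∀ {x y t} → Top x → Top y → x ≢ y → (w : Walk Arc x y (suc t)) → k ≤ Hlength {H} {D} w
  Tops-≢⇒k≤Hlength {x} {y} {t} x-top@(((u , ux) , inS , _) , _) y-top@((_ , inSʸ , _) , _) x≢y w =
    ≤-trans (k≤changes (classChanges≡0⇒classWalk A w) (properClassWalk (u , ux , refl) w))
            (classChanges≤Hlength hc A w)
    where
    A = cls u x
    A∈S = inS u ux
    -- Generalising over the number c of class changes lets us split on it.
    k≤changes : ∀ {c} → (c ≡ 0 → Walk (ClassArc P A) x y (suc t)) →
                ∃[ c′ ] (InNminus P y c′ × Walk (ProperArc {R = CArc P}) A c′ c) → k ≤ c
    k≤changes {zero} classWalk _ = ⊥-elim (x≢y (Top-unique x-top y-top (_ , sWalk)))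
      where sWalk = mapᵂ (λ (a , e) → a , subst (_∈ S) (sym e) A∈S) (classWalk refl)
    k≤changes {suc c} _ (c′ , (u′ , a′ , refl) , cw) = kernel-properWalk⇒k≤length ker cycles A∈S (inSʸ u′ a′) cw

  T-independent : ∀ x y → x ∈ T → y ∈ T → x ≢ y → ∀ t (w : Walk Arc x y t) → k ≤ Hlength {H} {D} w
  T-independent x y x∈T y∈T x≢y t w = separated (∈-toSubset⁻ inT? x∈T) (∈-toSubset⁻ inT? y∈T) w
    where
    separated : ∀ {t} → InT x → InT y → (w : Walk Arc x y t) → k ≤ Hlength {H} {D} w
    separated _                  _                  nil          = ⊥-elim (x≢y refl)
    separated (inj₁ (noOut , _)) _                  (cons a _)   = ⊥-elim (noOut _ a)
    separated (inj₂ _)           (inj₁ (_ , noIn))  w@(cons _ _) = ⊥-elim (noIn _ (proj₂ (lastArc w)))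
    separated (inj₂ x-top)       (inj₂ y-top)       w@(cons _ _) = Tops-≢⇒k≤Hlength x-top y-top x≢y w

proposition3 : (H : Digraph) (D : HColoredDigraph H) (P : ArcPartition D)
  → IsHClassPartition P
  → IsWalkPreservative P
  → (k l : ℕ) → 2 ≤ k → 1 ≤ l
  → (S : Subset (ArcPartition.p P))
  → IsKLKernel (CArc P) k l S
  → (∀ (i : Fin (ArcPartition.p P)) → ¬ IsSink (CArc P) i)
  → (∀ (i : Fin (ArcPartition.p P)) (t : ℕ) (c : Walk (CArc P) i i t)
       → IsCycle c → t ≡ 1 ⊎ k ≤ t)
  → (∀ (x : Fin (HColoredDigraph.n D))
       → (∃[ i ] (InN P x i × i ∈ S))
       → (∃[ j ] (InN P x j × InOutNbhd P S j))
       → ∀ (i : Fin (ArcPartition.p P)) → InNminus P x i → i ∈ S)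
  → ∃[ T ] IsKLHKernelByWalks {H} {D} k (l + 1) T
proposition3 H D P hc wp k l 2≤k _ S ker noSink cycles inClasses⊆S = T , T-independent , T-absorbent
  where open KernelByWalks {H} {D} {P} hc wp 2≤k ker noSink cycles inClasses⊆S
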